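{- For all positive integers $r,s$, $$\sum_{n=1}^{r^s}\big(c_{r,s}(n)\big)^2=r^s J_s(r^s).$$
   Context: For a positive integer $s$ and integers $a,b$ not both zero, $(a,b)_s$ denotes the largest $l^s$ ($l\in\mathbb{N}$) dividing both $a$ and $b$. The generalized Ramanujan sum is $c_{r,s}(n)=\sum_{1\le j\le r^s,\ (j,r^s)_s=1}\exp\left(\frac{2\pi i n j}{r^s}\right)$. Here $J_s(N)$ denotes the number of integers $k$ with $1\le k\le N$ and $(k,N)_s=1$. -}

module Defs where

open import Level using (Level)
open import Data.Nat using (ℕ; zero; suc; _^_; _⊔_; _≟_)
import Data.Nat as ℕ
open import Data.Product using (_×_)
open import Data.Sum using (_⊎_)
open import Relation.Nullary using (¬_)
open import Data.Nat.Divisibility using (_∣?_)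
open import Data.List using (List; map; filter; foldr; length; upTo)
open import Relation.Nullary.Decidable using (_×-dec_)
open import Algebra.Bundles using (CommutativeRing)

range1 : ℕ → List ℕ
range1 n = map suc (upTo n)

-- (a , b)_s : the largest l ^ s (l ∈ ℕ) dividing both a and b
-- (a, b not both zero).  For s ≥ 1 and such l we have l ≤ l ^ s ≤ a + b,
-- so it suffices to search l ∈ [1 .. a + b]; l = 1 always qualifies.
gcdPow : ℕ → ℕ → ℕ → ℕ
gcdPow s a b =
  foldr _⊔_ 1 (map (λ l → l ^ s)
    (filter (λ l → (l ^ s ∣? a) ×-dec (l ^ s ∣? b)) (range1 (a ℕ.+ b))))

J : ℕ → ℕ → ℕ
J s N = length (filter (λ k → gcdPow s k N ≟ 1) (range1 N))

module _ {c ℓ : Level} (R : CommutativeRing c ℓ) where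
  open CommutativeRing R

  pow : Carrier → ℕ → Carrier
  pow x zero = 1#
  pow x (suc n) = x * pow x n

  sumR : List Carrier → Carrier
  sumR = foldr _+_ 0#

  fromℕ : ℕ → Carrier
  fromℕ zero = 0#
  fromℕ (suc n) = 1# + fromℕ n

  PrimitiveRoot : ℕ → Carrier → Set ℓ
  PrimitiveRoot N ζ = (pow ζ N ≈ 1#) × (∀ k → 0 ℕ.< k → k ℕ.< N → ¬ (pow ζ k ≈ 1#))

  NoZeroDivisors : Set (c Level.⊔ ℓ)
  NoZeroDivisors = ∀ x y → x * y ≈ 0# → (x ≈ 0#) ⊎ (y ≈ 0#)

  -- generalized Ramanujan sum c_{r,s}(n) = Σ_{1 ≤ j ≤ r^s, (j, r^s)_s = 1} ζ^{n j},
  -- where ζ plays the role of exp(2πi / r^s)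
  ramanujan : Carrier → ℕ → ℕ → ℕ → Carrier
  ramanujan ζ r s n =
    sumR (map (λ j → pow ζ (n ℕ.* j))
      (filter (λ j → gcdPow s j (r ^ s) ≟ 1) (range1 (r ^ s))))

{-# OPTIONS --safe #-}
module Submission where

-- Write N = r ^ s and L for the j in [1 .. N] with (j , N)_s = 1. Expanding the square and
-- exchanging the sums turns the left-hand side into the sum over j, k ∈ L of
-- ∑_{n=1}^{N} (ζ^(j+k))^n. Over an integral domain this geometric sum is N when N ∣ j + k and
-- 0 otherwise, because ζ^(j+k) is then an N-th root of unity different from 1. For j ∈ L
-- exactly one k ∈ [1 .. N] has N ∣ j + k, namely k = N − (j mod N), and this k lies in L again,
-- since an s-th power dividing N and k also divides j. So each j ∈ L contributes N, and the
-- total is N · J_s(N).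

open import Defs
open import Level using (Level)
open import Function using (_∘_)
open import Data.Empty using (⊥; ⊥-elim)
open import Data.Nat as ℕ using (ℕ; zero; suc; _^_; NonZero)
import Data.Nat.Properties as ℕ
open import Data.Nat.Divisibility using (_∣_; divides; n∣m*n; m%n≡0⇒n∣m)
open import Data.Nat.DivMod using (_%_; _/_; m≡m%n+[m/n]*n; m%n<n)
open import Data.Product using (_,_; proj₁; proj₂)
open import Data.Sum using (inj₁; inj₂)
open import Data.List using (List; []; _∷_; [_]; _++_; map; filter; foldr; length; upTo)
open import Data.List.Membership.Propositional using (_∈_)
open import Data.List.Membership.Propositional.Properties using (∈-filter⁻)
open import Data.List.Relation.Unary.Any using (here; there)
import Data.List.Relation.Unary.All as All
open import Data.List.Relation.Unary.Unique.Propositional using (Unique; _∷_)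
open import Relation.Nullary using (¬_; yes; no)
open import Relation.Binary.PropositionalEquality as ≡ using (_≡_; _≢_)
open import Algebra.Bundles using (CommutativeMonoid; Semiring; CommutativeRing)

module Residues where

  open import Data.Nat using (_+_; _*_; _∸_; _⊔_; _≤_; _<_; _≟_; z≤n; s≤s)
  open import Data.Nat.Divisibility
    using (_∣?_; ∣⇒≤; ∣-refl; ∣m∣n⇒∣m+n; ∣m+n∣m⇒∣n; ∣n∣m%n⇒∣m)
  open import Data.Product using (_×_)
  open import Data.List.Properties using (map-++; length-map; length-upTo; upTo-∷ʳ)
  open import Data.List.Membership.Propositional.Properties
    using (∈-map⁺; ∈-map⁻; ∈-filter⁺; ∈-upTo⁺; ∈-upTo⁻)
  import Data.List.Relation.Unary.Unique.Propositional.Properties as Unique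
  open import Relation.Nullary using (Dec)
  open import Relation.Nullary.Decidable using (_×-dec_)
  open import Algebra.Properties.CommutativeSemigroup ℕ.+-commutativeSemigroup using (xy∙z≈y∙xz)

  ∈-range1⁺ : ∀ {k n} → 1 ≤ k → k ≤ n → k ∈ range1 n
  ∈-range1⁺ {suc k} (s≤s z≤n) k<n = ∈-map⁺ suc (∈-upTo⁺ k<n)

  ∈-range1⁻ : ∀ {k n} → k ∈ range1 n → 1 ≤ k × k ≤ n
  ∈-range1⁻ k∈ with _ , i∈ , ≡.refl ← ∈-map⁻ suc k∈ = s≤s z≤n , ∈-upTo⁻ i∈

  range1-suc : ∀ n → range1 (suc n) ≡ range1 n ++ [ suc n ]
  range1-suc n = ≡.trans (≡.cong (map suc) (≡.sym (upTo-∷ʳ n))) (map-++ suc (upTo n) [ n ])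

  length-range1 : ∀ n → length (range1 n) ≡ n
  length-range1 n = ≡.trans (length-map suc (upTo n)) (length-upTo n)

  unique-range1 : ∀ n → Unique (range1 n)
  unique-range1 n = Unique.map⁺ ℕ.suc-injective (Unique.upTo⁺ n)

  ∈⇒≤-foldr-⊔ : ∀ {x b xs} → x ∈ xs → x ≤ foldr _⊔_ b xs
  ∈⇒≤-foldr-⊔ {xs = y ∷ _} (here ≡.refl) = ℕ.m≤m⊔n y _
  ∈⇒≤-foldr-⊔ {xs = y ∷ _} (there x∈) = ℕ.≤-trans (∈⇒≤-foldr-⊔ x∈) (ℕ.m≤n⊔m y _)

  foldr-⊔-≡ : ∀ {b} xs → (∀ {x} → x ∈ xs → x ≤ b) → foldr _⊔_ b xs ≡ b
  foldr-⊔-≡ [] _ = ≡.refl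
  foldr-⊔-≡ (y ∷ ys) ≤b rewrite foldr-⊔-≡ ys (≤b ∘ there) =
    ℕ.m≤n⇒m⊔n≡n (≤b (here ≡.refl))

  m≤m^n : ∀ m n .{{_ : NonZero m}} .{{_ : NonZero n}} → m ≤ m ^ n
  m≤m^n m (suc n) = ℕ.m≤m*n m (m ^ n) {{ℕ.m^n≢0 m n}}

  PowerCoprime : ℕ → ℕ → ℕ → Set
  PowerCoprime s a b = ∀ l → 2 ≤ l → l ^ s ∣ a → l ^ s ∣ b → ⊥

  commonPower? : ∀ s a b l → Dec (l ^ s ∣ a × l ^ s ∣ b)
  commonPower? s a b l = (l ^ s ∣? a) ×-dec (l ^ s ∣? b)

  gcdPow≡1⇒PowerCoprime : ∀ s a b .{{_ : NonZero s}} .{{_ : NonZero b}} →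
                          gcdPow s a b ≡ 1 → PowerCoprime s a b
  gcdPow≡1⇒PowerCoprime s a b gcd≡1 l@(suc _) 2≤l lˢ∣a lˢ∣b =
    ℕ.<-irrefl ≡.refl
      (ℕ.≤-trans 2≤l (ℕ.≤-trans (m≤m^n l s) (≡.subst (l ^ s ≤_) gcd≡1 lˢ≤gcd)))
    where
    l≤a+b : l ≤ a + b
    l≤a+b = ℕ.≤-trans (m≤m^n l s) (ℕ.≤-trans (∣⇒≤ lˢ∣b) (ℕ.m≤n+m b a))
    lˢ≤gcd : l ^ s ≤ gcdPow s a b
    lˢ≤gcd = ∈⇒≤-foldr-⊔ (∈-map⁺ (_^ s)
      (∈-filter⁺ (commonPower? s a b) (∈-range1⁺ (s≤s z≤n) l≤a+b) (lˢ∣a , lˢ∣b)))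

  PowerCoprime⇒gcdPow≡1 : ∀ s a b → PowerCoprime s a b → gcdPow s a b ≡ 1
  PowerCoprime⇒gcdPow≡1 s a b coprime = foldr-⊔-≡ _ bound
    where
    lˢ≤1 : ∀ {l} → 1 ≤ l → l ^ s ∣ a → l ^ s ∣ b → l ^ s ≤ 1
    lˢ≤1 {1} _ _ _ = ℕ.≤-reflexive (ℕ.^-zeroˡ s)
    lˢ≤1 {suc (suc _)} _ lˢ∣a lˢ∣b = ⊥-elim (coprime _ (s≤s (s≤s z≤n)) lˢ∣a lˢ∣b)
    bound : ∀ {x} → x ∈ map (_^ s) (filter (commonPower? s a b) (range1 (a + b))) → x ≤ 1
    bound x∈ with _ , l∈ , ≡.refl ← ∈-map⁻ (_^ s) x∈
             with l∈range , lˢ∣a , lˢ∣b ← ∈-filter⁻ (commonPower? s a b) {xs = range1 (a + b)} l∈ =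
      lˢ≤1 (proj₁ (∈-range1⁻ l∈range)) lˢ∣a lˢ∣b

  m∣n∧0<n<m+m⇒n≡m : ∀ {m n} → m ∣ n → 0 < n → n < m + m → n ≡ m
  m∣n∧0<n<m+m⇒n≡m {m} (divides 1 ≡.refl) _ _ = ℕ.+-identityʳ m
  m∣n∧0<n<m+m⇒n≡m {m} (divides (suc (suc q)) ≡.refl) _ n<m+m =
    ⊥-elim (ℕ.<⇒≱ n<m+m (ℕ.+-monoʳ-≤ m (ℕ.m≤m+n m (q * m))))

  module _ (N : ℕ) .{{_ : NonZero N}} where

    -- The representative of −j modulo N in [1 .. N]: it is N, not 0, when N ∣ j.
    opposite : ℕ → ℕ
    opposite j = N ∸ j % N

    j+k≡[j/N]*N+[j%N+k] : ∀ j k → j + k ≡ (j / N) * N + (j % N + k)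
    j+k≡[j/N]*N+[j%N+k] j k = ≡.trans (≡.cong (_+ k) (m≡m%n+[m/n]*n j N)) (xy∙z≈y∙xz (j % N) _ k)

    j%N+opposite≡N : ∀ j → j % N + opposite j ≡ N
    j%N+opposite≡N j = ℕ.m+[n∸m]≡n (ℕ.<⇒≤ (m%n<n j N))

    opposite∈range1 : ∀ j → opposite j ∈ range1 N
    opposite∈range1 j = ∈-range1⁺ (ℕ.m<n⇒0<n∸m (m%n<n j N)) (ℕ.m∸n≤m N (j % N))

    ∣j+opposite : ∀ j → N ∣ j + opposite j
    ∣j+opposite j = ≡.subst (N ∣_) (≡.sym (j+k≡[j/N]*N+[j%N+k] j (opposite j)))
      (∣m∣n⇒∣m+n (n∣m*n (j / N)) (≡.subst (N ∣_) (≡.sym (j%N+opposite≡N j)) ∣-refl))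

    ∣j+k⇒k≡opposite : ∀ j {k} → k ∈ range1 N → N ∣ j + k → k ≡ opposite j
    ∣j+k⇒k≡opposite j {k} k∈ N∣j+k with 1≤k , k≤N ← ∈-range1⁻ k∈ = begin
      k                     ≡⟨ ℕ.m+n∸m≡n (j % N) k ⟨
      (j % N + k) ∸ j % N   ≡⟨ ≡.cong (_∸ j % N) j%N+k≡N ⟩
      N ∸ j % N             ∎
      where
      open ≡.≡-Reasoning
      j%N+k≡N : j % N + k ≡ N
      j%N+k≡N = m∣n∧0<n<m+m⇒n≡m
        (∣m+n∣m⇒∣n (≡.subst (N ∣_) (j+k≡[j/N]*N+[j%N+k] j k) N∣j+k) (n∣m*n (j / N)))
        (ℕ.≤-trans 1≤k (ℕ.m≤n+m k (j % N)))
        (ℕ.+-mono-<-≤ (m%n<n j N) k≤N)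

    opposite-PowerCoprime : ∀ s j → PowerCoprime s j N → PowerCoprime s (opposite j) N
    opposite-PowerCoprime s j coprime l 2≤l lˢ∣opposite lˢ∣N = coprime l 2≤l lˢ∣j lˢ∣N
      where
      N≡opposite+j%N : N ≡ opposite j + j % N
      N≡opposite+j%N = ≡.trans (≡.sym (j%N+opposite≡N j)) (ℕ.+-comm (j % N) _)
      lˢ∣j : l ^ s ∣ j
      lˢ∣j = ∣n∣m%n⇒∣m lˢ∣N (∣m+n∣m⇒∣n (≡.subst (l ^ s ∣_) N≡opposite+j%N lˢ∣N) lˢ∣opposite)

  coprime? : ∀ s N k → Dec (gcdPow s k N ≡ 1)
  coprime? s N k = gcdPow s k N ≟ 1

  coprimes : ℕ → ℕ → List ℕ
  coprimes s N = filter (coprime? s N) (range1 N)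

  unique-coprimes : ∀ s N → Unique (coprimes s N)
  unique-coprimes s N = Unique.filter⁺ (coprime? s N) (unique-range1 N)

  opposite∈coprimes : ∀ s N .{{_ : NonZero s}} .{{_ : NonZero N}} {j} →
                      j ∈ coprimes s N → opposite N j ∈ coprimes s N
  opposite∈coprimes s N {j} j∈ with _ , gcd≡1 ← ∈-filter⁻ (coprime? s N) {xs = range1 N} j∈ =
    ∈-filter⁺ (coprime? s N) (opposite∈range1 N j)
      (PowerCoprime⇒gcdPow≡1 s _ N (opposite-PowerCoprime N s j (gcdPow≡1⇒PowerCoprime s j N gcd≡1)))

open Residues

module FiniteSums {c ℓ} (M : CommutativeMonoid c ℓ) where

  open CommutativeMonoid M renaming (_∙_ to _+_; ε to 0#; ∙-cong to +-cong; ∙-congˡ to +-congˡ)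
  open import Algebra.Definitions.RawMonoid rawMonoid public using (_×_)
  open import Algebra.Properties.CommutativeSemigroup commutativeSemigroup using (interchange)
  open import Relation.Binary.Reasoning.Setoid setoid

  ∑ : List Carrier → Carrier
  ∑ = foldr _+_ 0#

  ∑-syntax : ∀ {a} {A : Set a} → List A → (A → Carrier) → Carrier
  ∑-syntax xs f = ∑ (map f xs)

  syntax ∑-syntax xs (λ x → e) = ∑[ x ∈ xs ] e

  module _ {a} {A : Set a} where

    ∑-cong : ∀ {f g : A → Carrier} xs → (∀ {x} → x ∈ xs → f x ≈ g x) →
             ∑[ x ∈ xs ] f x ≈ ∑[ x ∈ xs ] g x
    ∑-cong [] _ = refl
    ∑-cong (x ∷ xs) f≈g = +-cong (f≈g (here ≡.refl)) (∑-cong xs (f≈g ∘ there))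

    ∑-zero : ∀ {f : A → Carrier} xs → (∀ {x} → x ∈ xs → f x ≈ 0#) → ∑[ x ∈ xs ] f x ≈ 0#
    ∑-zero [] _ = refl
    ∑-zero (x ∷ xs) f≈0 = trans (+-cong (f≈0 (here ≡.refl)) (∑-zero xs (f≈0 ∘ there))) (identityˡ 0#)

    ∑-++ : ∀ (f : A → Carrier) xs ys → ∑[ x ∈ xs ++ ys ] f x ≈ ∑[ x ∈ xs ] f x + ∑[ y ∈ ys ] f y
    ∑-++ f [] ys = sym (identityˡ _)
    ∑-++ f (x ∷ xs) ys = trans (+-congˡ (∑-++ f xs ys)) (sym (assoc _ _ _))

    ∑-distrib-+ : ∀ (f g : A → Carrier) xs →
                  ∑[ x ∈ xs ] (f x + g x) ≈ ∑[ x ∈ xs ] f x + ∑[ x ∈ xs ] g x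
    ∑-distrib-+ f g [] = sym (identityˡ 0#)
    ∑-distrib-+ f g (x ∷ xs) = trans (+-congˡ (∑-distrib-+ f g xs)) (interchange _ _ _ _)

    ∑-const : ∀ y (xs : List A) → ∑[ x ∈ xs ] y ≈ length xs × y
    ∑-const y [] = refl
    ∑-const y (x ∷ xs) = +-congˡ (∑-const y xs)

    ∑-unique : ∀ {f : A → Carrier} {x₀} xs → Unique xs → x₀ ∈ xs →
               (∀ {x} → x ∈ xs → x ≢ x₀ → f x ≈ 0#) → ∑[ x ∈ xs ] f x ≈ f x₀
    ∑-unique {f} (x ∷ xs) (x∉xs ∷ _) (here ≡.refl) f≈0 = begin
      f x + ∑[ y ∈ xs ] f y  ≈⟨ +-congˡ (∑-zero xs λ y∈ → f≈0 (there y∈) (All.lookup x∉xs y∈ ∘ ≡.sym)) ⟩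
      f x + 0#               ≈⟨ identityʳ (f x) ⟩
      f x                    ∎
    ∑-unique {f} {x₀} (x ∷ xs) (x∉xs ∷ unique) (there x₀∈) f≈0 = begin
      f x + ∑[ y ∈ xs ] f y  ≈⟨ +-cong (f≈0 (here ≡.refl) (All.lookup x∉xs x₀∈))
                                       (∑-unique xs unique x₀∈ (f≈0 ∘ there)) ⟩
      0# + f x₀              ≈⟨ identityˡ (f x₀) ⟩
      f x₀                   ∎

  ∑-range1-suc : ∀ (f : ℕ → Carrier) n →
                 ∑[ k ∈ range1 (suc n) ] f k ≈ ∑[ k ∈ range1 n ] f k + f (suc n)
  ∑-range1-suc f n = begin
    ∑[ k ∈ range1 (suc n) ] f k                ≡⟨ ≡.cong (λ ks → ∑[ k ∈ ks ] f k) (range1-suc n) ⟩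
    ∑[ k ∈ range1 n ++ [ suc n ] ] f k         ≈⟨ ∑-++ f (range1 n) [ suc n ] ⟩
    ∑[ k ∈ range1 n ] f k + (f (suc n) + 0#)   ≈⟨ +-congˡ (identityʳ _) ⟩
    ∑[ k ∈ range1 n ] f k + f (suc n)          ∎

  ∑-comm : ∀ {a b} {A : Set a} {B : Set b} (f : A → B → Carrier) xs ys →
           ∑[ x ∈ xs ] ∑[ y ∈ ys ] f x y ≈ ∑[ y ∈ ys ] ∑[ x ∈ xs ] f x y
  ∑-comm f [] ys = sym (∑-zero ys λ _ → refl)
  ∑-comm f (x ∷ xs) ys = trans (+-congˡ (∑-comm f xs ys)) (sym (∑-distrib-+ (f x) _ ys))

module SemiringSums {c ℓ} (R : Semiring c ℓ) where

  open Semiring R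
  open FiniteSums +-commutativeMonoid public
  open import Relation.Binary.Reasoning.Setoid setoid

  module _ {a} {A : Set a} where

    ∑-distribˡ : ∀ y (f : A → Carrier) xs → y * ∑[ x ∈ xs ] f x ≈ ∑[ x ∈ xs ] (y * f x)
    ∑-distribˡ y f [] = zeroʳ y
    ∑-distribˡ y f (x ∷ xs) = trans (distribˡ y _ _) (+-congˡ (∑-distribˡ y f xs))

    ∑-distribʳ : ∀ y (f : A → Carrier) xs → ∑[ x ∈ xs ] f x * y ≈ ∑[ x ∈ xs ] (f x * y)
    ∑-distribʳ y f [] = zeroˡ y
    ∑-distribʳ y f (x ∷ xs) = trans (distribʳ y _ _) (+-congˡ (∑-distribʳ y f xs))

  ∑-*-∑ : ∀ {a b} {A : Set a} {B : Set b} (f : A → Carrier) (g : B → Carrier) xs ys →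
          ∑[ x ∈ xs ] f x * ∑[ y ∈ ys ] g y ≈ ∑[ x ∈ xs ] ∑[ y ∈ ys ] (f x * g y)
  ∑-*-∑ f g xs ys = trans (∑-distribʳ _ f xs) (∑-cong xs λ {x} _ → ∑-distribˡ (f x) g ys)

  ∑-square : ∀ {a b} {A : Set a} {B : Set b} (f : A → B → Carrier) xs ys →
             ∑[ x ∈ xs ] (∑[ y ∈ ys ] f x y * ∑[ z ∈ ys ] f x z) ≈
             ∑[ y ∈ ys ] ∑[ z ∈ ys ] ∑[ x ∈ xs ] (f x y * f x z)
  ∑-square f xs ys = begin
    ∑[ x ∈ xs ] (∑[ y ∈ ys ] f x y * ∑[ z ∈ ys ] f x z)
      ≈⟨ ∑-cong xs (λ {x} _ → ∑-*-∑ (f x) (f x) ys ys) ⟩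
    ∑[ x ∈ xs ] ∑[ y ∈ ys ] ∑[ z ∈ ys ] (f x y * f x z)
      ≈⟨ ∑-comm _ xs ys ⟩
    ∑[ y ∈ ys ] ∑[ x ∈ xs ] ∑[ z ∈ ys ] (f x y * f x z)
      ≈⟨ ∑-cong ys (λ {y} _ → ∑-comm (λ x z → f x y * f x z) xs ys) ⟩
    ∑[ y ∈ ys ] ∑[ z ∈ ys ] ∑[ x ∈ xs ] (f x y * f x z)  ∎

module CommutativeRingSums {c ℓ} (R : CommutativeRing c ℓ) where

  open CommutativeRing R
  open SemiringSums semiring public
  import Algebra.Properties.Semiring.Exp semiring as Exp
  open import Algebra.Properties.Monoid.Mult +-monoid using (×-assocˡ)
  open import Algebra.Properties.CommutativeSemigroup +-commutativeSemigroup using (xy∙z≈xz∙y)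
  open import Algebra.Properties.Ring ring using (-1*x≈-x)
  open import Algebra.Properties.Group +-group using (∙-cancelʳ; x∙y⁻¹≈ε⇒x≈y; x≈y⇒x∙y⁻¹≈ε)
  open import Relation.Binary.Reasoning.Setoid setoid

  pow≡^ : ∀ x n → pow R x n ≡ x Exp.^ n
  pow≡^ x zero = ≡.refl
  pow≡^ x (suc n) = ≡.cong (x *_) (pow≡^ x n)

  pow-cong : ∀ {x y} n → x ≈ y → pow R x n ≈ pow R y n
  pow-cong zero _ = refl
  pow-cong (suc n) x≈y = *-cong x≈y (pow-cong n x≈y)

  pow-1# : ∀ n → pow R 1# n ≈ 1#
  pow-1# zero = refl
  pow-1# (suc n) = trans (*-identityˡ _) (pow-1# n)

  pow-homo-+ : ∀ x m n → pow R x (m ℕ.+ n) ≈ pow R x m * pow R x n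
  pow-homo-+ x m n = begin
    pow R x (m ℕ.+ n)          ≡⟨ pow≡^ x (m ℕ.+ n) ⟩
    x Exp.^ (m ℕ.+ n)          ≈⟨ Exp.^-homo-* x m n ⟩
    x Exp.^ m * x Exp.^ n      ≡⟨ ≡.cong₂ _*_ (pow≡^ x m) (pow≡^ x n) ⟨
    pow R x m * pow R x n      ∎

  pow-pow : ∀ x m n → pow R (pow R x m) n ≈ pow R x (m ℕ.* n)
  pow-pow x m n = begin
    pow R (pow R x m) n        ≡⟨ ≡.trans (pow≡^ _ n) (≡.cong (Exp._^ n) (pow≡^ x m)) ⟩
    (x Exp.^ m) Exp.^ n        ≈⟨ Exp.^-assocʳ x m n ⟩
    x Exp.^ (m ℕ.* n)          ≡⟨ pow≡^ x (m ℕ.* n) ⟨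
    pow R x (m ℕ.* n)          ∎

  pow-*-pow : ∀ x n j k → pow R x (n ℕ.* j) * pow R x (n ℕ.* k) ≈ pow R (pow R x (j ℕ.+ k)) n
  pow-*-pow x n j k = begin
    pow R x (n ℕ.* j) * pow R x (n ℕ.* k)  ≈⟨ pow-homo-+ x (n ℕ.* j) (n ℕ.* k) ⟨
    pow R x (n ℕ.* j ℕ.+ n ℕ.* k)          ≡⟨ ≡.cong (pow R x) (ℕ.*-distribˡ-+ n j k) ⟨
    pow R x (n ℕ.* (j ℕ.+ k))              ≡⟨ ≡.cong (pow R x) (ℕ.*-comm n (j ℕ.+ k)) ⟩
    pow R x ((j ℕ.+ k) ℕ.* n)              ≈⟨ pow-pow x (j ℕ.+ k) n ⟨
    pow R (pow R x (j ℕ.+ k)) n            ∎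

  fromℕ≡×1# : ∀ n → fromℕ R n ≡ n × 1#
  fromℕ≡×1# zero = ≡.refl
  fromℕ≡×1# (suc n) = ≡.cong (1# +_) (fromℕ≡×1# n)

  ×-fromℕ : ∀ m n → m × fromℕ R n ≈ fromℕ R (m ℕ.* n)
  ×-fromℕ m n = begin
    m × fromℕ R n            ≡⟨ ≡.cong (m ×_) (fromℕ≡×1# n) ⟩
    m × (n × 1#)             ≈⟨ ×-assocˡ 1# m n ⟩
    (m ℕ.* n) × 1#           ≡⟨ fromℕ≡×1# (m ℕ.* n) ⟨
    fromℕ R (m ℕ.* n)        ∎

  geometric-shift : ∀ ω n →
    ω * ∑[ k ∈ range1 n ] pow R ω k + ω ≈ ∑[ k ∈ range1 n ] pow R ω k + pow R ω (suc n)
  geometric-shift ω zero = begin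
    ω * 0# + ω    ≈⟨ +-congʳ (zeroʳ ω) ⟩
    0# + ω        ≈⟨ +-congˡ (*-identityʳ ω) ⟨
    0# + ω * 1#   ∎
  geometric-shift ω (suc n) = begin
    ω * G (suc n) + ω        ≈⟨ +-congʳ (*-congˡ (∑-range1-suc (pow R ω) n)) ⟩
    ω * (G n + p) + ω        ≈⟨ +-congʳ (distribˡ ω _ p) ⟩
    ω * G n + ω * p + ω      ≈⟨ xy∙z≈xz∙y _ _ ω ⟩
    ω * G n + ω + ω * p      ≈⟨ +-congʳ (geometric-shift ω n) ⟩
    G n + p + ω * p          ≈⟨ +-congʳ (∑-range1-suc (pow R ω) n) ⟨
    G (suc n) + ω * p        ∎
    where
    G : ℕ → Carrier
    G m = ∑[ k ∈ range1 m ] pow R ω k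
    p : Carrier
    p = pow R ω (suc n)

  ∑-pow≈fromℕ : ∀ {ω} n → ω ≈ 1# → ∑[ k ∈ range1 n ] pow R ω k ≈ fromℕ R n
  ∑-pow≈fromℕ {ω} n ω≈1 = begin
    ∑[ k ∈ range1 n ] pow R ω k  ≈⟨ ∑-cong (range1 n) (λ {k} _ → trans (pow-cong k ω≈1) (pow-1# k)) ⟩
    ∑[ k ∈ range1 n ] 1#         ≈⟨ ∑-const 1# (range1 n) ⟩
    length (range1 n) × 1#       ≡⟨ ≡.cong (_× 1#) (length-range1 n) ⟩
    n × 1#                       ≡⟨ fromℕ≡×1# n ⟨
    fromℕ R n                    ∎

  ∑-pow≈0# : NoZeroDivisors R → ∀ {ω} n → ¬ ω ≈ 1# → pow R ω n ≈ 1# →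
             ∑[ k ∈ range1 n ] pow R ω k ≈ 0#
  ∑-pow≈0# noZeroDivisors {ω} n ω≉1 ωⁿ≈1
    with noZeroDivisors (ω + - 1#) G [ω-1]G≈0
    where
    G : Carrier
    G = ∑[ k ∈ range1 n ] pow R ω k
    ωG≈G : ω * G ≈ G
    ωG≈G = ∙-cancelʳ ω _ _
      (trans (geometric-shift ω n) (+-congˡ (trans (*-congˡ ωⁿ≈1) (*-identityʳ ω))))
    [ω-1]G≈0 : (ω + - 1#) * G ≈ 0#
    [ω-1]G≈0 = begin
      (ω + - 1#) * G     ≈⟨ distribʳ G ω (- 1#) ⟩
      ω * G + - 1# * G   ≈⟨ +-cong ωG≈G (-1*x≈-x G) ⟩
      G + - G            ≈⟨ x≈y⇒x∙y⁻¹≈ε refl ⟩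
      0#                 ∎
  ... | inj₁ ω-1≈0 = ⊥-elim (ω≉1 (x∙y⁻¹≈ε⇒x≈y ω 1# ω-1≈0))
  ... | inj₂ G≈0 = G≈0

module PrimitiveRootSums {c ℓ} (R : CommutativeRing c ℓ) (noZeroDivisors : NoZeroDivisors R)
                         (N : ℕ) .{{_ : NonZero N}}
                         (ζ : CommutativeRing.Carrier R) (ζ-primitive : PrimitiveRoot R N ζ) where

  open CommutativeRing R
  open CommutativeRingSums R
  open import Relation.Binary.Reasoning.Setoid setoid

  ∣⇒pow≈1# : ∀ {m} → N ∣ m → pow R ζ m ≈ 1#
  ∣⇒pow≈1# (divides q ≡.refl) = begin
    pow R ζ (q ℕ.* N)     ≡⟨ ≡.cong (pow R ζ) (ℕ.*-comm q N) ⟩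
    pow R ζ (N ℕ.* q)     ≈⟨ pow-pow ζ N q ⟨
    pow R (pow R ζ N) q   ≈⟨ pow-cong q (proj₁ ζ-primitive) ⟩
    pow R 1# q            ≈⟨ pow-1# q ⟩
    1#                    ∎

  pow≈1#⇒∣ : ∀ {m} → pow R ζ m ≈ 1# → N ∣ m
  pow≈1#⇒∣ {m} ζᵐ≈1 with m % N ℕ.≟ 0
  ... | yes m%N≡0 = m%n≡0⇒n∣m m N m%N≡0
  ... | no m%N≢0 = ⊥-elim (proj₂ ζ-primitive (m % N) (ℕ.n≢0⇒n>0 m%N≢0) (m%n<n m N) (begin
    pow R ζ (m % N)                              ≈⟨ *-identityʳ _ ⟨
    pow R ζ (m % N) * 1#                         ≈⟨ *-congˡ (∣⇒pow≈1# (n∣m*n (m / N))) ⟨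
    pow R ζ (m % N) * pow R ζ (m / N ℕ.* N)      ≈⟨ pow-homo-+ ζ (m % N) _ ⟨
    pow R ζ (m % N ℕ.+ m / N ℕ.* N)              ≡⟨ ≡.cong (pow R ζ) (m≡m%n+[m/n]*n m N) ⟨
    pow R ζ m                                    ≈⟨ ζᵐ≈1 ⟩
    1#                                           ∎))

  ∑-pow-pow-∣ : ∀ {m} → N ∣ m → ∑[ n ∈ range1 N ] pow R (pow R ζ m) n ≈ fromℕ R N
  ∑-pow-pow-∣ N∣m = ∑-pow≈fromℕ N (∣⇒pow≈1# N∣m)

  ∑-pow-pow-∤ : ∀ {m} → ¬ N ∣ m → ∑[ n ∈ range1 N ] pow R (pow R ζ m) n ≈ 0#
  ∑-pow-pow-∤ {m} N∤m = ∑-pow≈0# noZeroDivisors N (N∤m ∘ pow≈1#⇒∣)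
    (trans (pow-pow ζ m N) (∣⇒pow≈1# (n∣m*n m)))

  ∑-coprimes-∑-pow : ∀ s .{{_ : NonZero s}} {j} → j ∈ coprimes s N →
    ∑[ k ∈ coprimes s N ] ∑[ n ∈ range1 N ] pow R (pow R ζ (j ℕ.+ k)) n ≈ fromℕ R N
  ∑-coprimes-∑-pow s {j} j∈ = trans
    (∑-unique (coprimes s N) (unique-coprimes s N) (opposite∈coprimes s N j∈) vanish)
    (∑-pow-pow-∣ (∣j+opposite N j))
    where
    vanish : ∀ {k} → k ∈ coprimes s N → k ≢ opposite N j →
             ∑[ n ∈ range1 N ] pow R (pow R ζ (j ℕ.+ k)) n ≈ 0#
    vanish k∈ k≢opposite = ∑-pow-pow-∤ λ N∣j+k →
      k≢opposite (∣j+k⇒k≡opposite N j (proj₁ (∈-filter⁻ (coprime? s N) k∈)) N∣j+k)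

mainTheorem5 : {c ℓ : Level} (R : CommutativeRing c ℓ) →
    let open CommutativeRing R in
    ¬ (1# ≈ 0#) → NoZeroDivisors R →
    (r s : ℕ) → .{{NonZero r}} → .{{NonZero s}} →
    (ζ : Carrier) → PrimitiveRoot R (r ^ s) ζ →
    sumR R (map (λ n → ramanujan R ζ r s n * ramanujan R ζ r s n) (range1 (r ^ s)))
      ≈ fromℕ R (r ^ s ℕ.* J s (r ^ s))
mainTheorem5 R _ noZeroDivisors r s ζ ζ-primitive = begin
  ∑[ n ∈ range1 N ] (∑[ j ∈ L ] pow R ζ (n ℕ.* j) * ∑[ k ∈ L ] pow R ζ (n ℕ.* k))
    ≈⟨ ∑-square (λ n j → pow R ζ (n ℕ.* j)) (range1 N) L ⟩
  ∑[ j ∈ L ] ∑[ k ∈ L ] ∑[ n ∈ range1 N ] (pow R ζ (n ℕ.* j) * pow R ζ (n ℕ.* k))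
    ≈⟨ ∑-cong L (λ {j} _ → ∑-cong L λ {k} _ → ∑-cong (range1 N) λ {n} _ → pow-*-pow ζ n j k) ⟩
  ∑[ j ∈ L ] ∑[ k ∈ L ] ∑[ n ∈ range1 N ] pow R (pow R ζ (j ℕ.+ k)) n
    ≈⟨ ∑-cong L (∑-coprimes-∑-pow s) ⟩
  ∑[ j ∈ L ] fromℕ R N
    ≈⟨ ∑-const (fromℕ R N) L ⟩
  length L × fromℕ R N
    ≈⟨ ×-fromℕ (length L) N ⟩
  fromℕ R (length L ℕ.* N)
    ≡⟨ ≡.cong (fromℕ R) (ℕ.*-comm (length L) N) ⟩
  fromℕ R (N ℕ.* J s N) ∎
  where
  open CommutativeRing R
  open CommutativeRingSums R
  open import Relation.Binary.Reasoning.Setoid setoid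
  N : ℕ
  N = r ^ s
  instance
    N≢0 : NonZero N
    N≢0 = ℕ.m^n≢0 r s
  open PrimitiveRootSums R noZeroDivisors N ζ ζ-primitive
  L : List ℕ
  L = coprimes s N
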